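{- Let $k\in\mathbb{N}$. For every vector $\mathbf{b}\in\mathbb{N}^{k+1}$ and every $x\in\mathbb{N}$, the set $\{\mathbf{a}\in\mathbb{N}^{k+1}\mid\exists y\in\mathbb{N}:(\mathbf{b},y)\leadsto_N(\mathbf{a},x)\}$ is finite.
   Context: Consider pairs $(\mathbf{a},x)$ with $\mathbf{a}=(a_k,\dots,a_0)\in\mathbb{N}^{k+1}$ and $x\in\mathbb{N}$. There are two kinds of rewrite rules. - For $1\le j\le k$, rule $N1_j$ applies when $a_j\ge1$. It maps $(\mathbf{a},x)$ to $(\mathbf{a}',x)$, where $a'_j=a_j-1$, $a'_{j-1}=x+1$, and all other components are unchanged. - Rule $N2$ applies when $a_0\ge1$. It maps $(a_k,\dots,a_1,a_0;x)$ to $(a_k,\dots,a_1,a_0-1;x+1)$. Write $(\mathbf{b},y)\leadsto_N(\mathbf{a},x)$ if $(\mathbf{a},x)$ is obtained from $(\mathbf{b},y)$ by a finite sequence of applications of rules from $\{N1_j\mid 1\le j\le k\}\cup\{N2\}$. -}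

module Defs where

open import Data.Nat using (ℕ; zero; suc)
open import Data.Fin using (Fin; inject₁) renaming (zero to fzero; suc to fsuc)
open import Data.Vec using (Vec; lookup; _[_]≔_)
open import Data.Product using (_×_; _,_; ∃)
open import Data.List using (List)
open import Data.List.Membership.Propositional using (_∈_)
open import Relation.Binary.PropositionalEquality using (_≡_)
open import Relation.Binary.Construct.Closure.ReflexiveTransitive using (Star)

-- A vector a = (a_k, …, a_0) ∈ ℕ^{k+1} is represented as Vec ℕ (suc k),
-- where  lookup a j  is the component a_j  (j : Fin (suc k), j = 0..k).
Config : ℕ → Set
Config k = Vec ℕ (suc k) × ℕ

data Step {k : ℕ} : Config k → Config k → Set where
  -- rule N1_j for j = i+1 (1 ≤ j ≤ k): needs a_j ≥ 1;
  -- a_j := a_j - 1, a_{j-1} := x + 1.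
  N1 : ∀ (i : Fin k) (a : Vec ℕ (suc k)) (x n : ℕ) →
       lookup a (fsuc i) ≡ suc n →
       Step (a , x) (((a [ fsuc i ]≔ n) [ inject₁ i ]≔ suc x) , x)
  N2 : ∀ (a : Vec ℕ (suc k)) (x n : ℕ) →
       lookup a fzero ≡ suc n →
       Step (a , x) ((a [ fzero ]≔ n) , suc x)

_⇝N_ : {k : ℕ} → Config k → Config k → Set
_⇝N_ = Star Step

IsFinite : {A : Set} → (A → Set) → Set
IsFinite {A} P = ∃ λ (l : List A) → ∀ a → P a → a ∈ l

module Submission where

-- The counter never decreases, and a rule either decrements an entry or writes
-- x' + 1, where x' is the current counter and hence at most the final one.  So
-- along a derivation ending with counter x, every entry stays bounded by
-- C = Σ b + (x + 1), and only finitely many vectors have all entries ≤ C.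

open import Defs
open import Data.Nat using (ℕ; zero; suc; _+_; _≤_; _<_; s≤s)
open import Data.Nat.Properties using (≤-refl; ≤-trans; <⇒≤; ≤-<-trans; m≤m+n; m≤n+m)
open import Data.Vec using (Vec; []; _∷_; lookup; _[_]≔_; sum)
open import Data.Vec.Relation.Unary.All as All using (All; []; _∷_)
open import Data.Vec.Relation.Unary.All.Properties using (lookup⁺)
open import Data.Fin using (Fin; inject₁) renaming (zero to fzero; suc to fsuc)
open import Data.Product using (∃; _,_)
open import Data.List using (List; []; _∷_; cartesianProductWith; upTo)
open import Data.List.Membership.Propositional using (_∈_)
open import Data.List.Membership.Propositional.Properties using (∈-cartesianProductWith⁺; ∈-upTo⁺)
open import Data.List.Relation.Unary.Any using (here)
open import Function using (_∘_)
open import Relation.Binary.PropositionalEquality using (_≡_; refl; subst)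
open import Relation.Binary.Construct.Closure.ReflexiveTransitive using (ε; _◅_)

vecsBoundedBy : ℕ → (n : ℕ) → List (Vec ℕ n)
vecsBoundedBy C zero    = [] ∷ []
vecsBoundedBy C (suc n) = cartesianProductWith _∷_ (upTo (suc C)) (vecsBoundedBy C n)

∈-vecsBoundedBy : ∀ {C n} {v : Vec ℕ n} → All (_≤ C) v → v ∈ vecsBoundedBy C n
∈-vecsBoundedBy []       = here refl
∈-vecsBoundedBy (x≤C ∷ h) =
  ∈-cartesianProductWith⁺ _∷_ (∈-upTo⁺ (s≤s x≤C)) (∈-vecsBoundedBy h)

All-≤-sum : ∀ {n} (v : Vec ℕ n) → All (_≤ sum v) v
All-≤-sum []      = []
All-≤-sum (x ∷ v) =
  m≤m+n x (sum v) ∷ All.map (λ y≤Σv → ≤-trans y≤Σv (m≤n+m (sum v) x)) (All-≤-sum v)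

All-[]≔ : ∀ {A : Set} {P : A → Set} {n} {xs : Vec A n} {y : A} (i : Fin n) →
  All P xs → P y → All P (xs [ i ]≔ y)
All-[]≔ fzero    (_ ∷ pxs)  py = py ∷ pxs
All-[]≔ (fsuc i) (px ∷ pxs) py = px ∷ All-[]≔ i pxs py

decremented-≤ : ∀ {C n m} {a : Vec ℕ n} (j : Fin n) → All (_≤ C) a → lookup a j ≡ suc m → m ≤ C
decremented-≤ {C} j a≤C aⱼ≡1+m = <⇒≤ (subst (_≤ C) aⱼ≡1+m (lookup⁺ a≤C j))

-- Guarded by y ≤ x so that it holds trivially once the counter has passed x and
-- is inherited forward: the counter only grows along a derivation.
BoundedUpTo : ∀ {k} → ℕ → ℕ → Config k → Set
BoundedUpTo C x (a , y) = y ≤ x → All (_≤ C) a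

Step-preserves-BoundedUpTo : ∀ {k C x} {c c′ : Config k} → x < C →
  Step c c′ → BoundedUpTo C x c → BoundedUpTo C x c′
Step-preserves-BoundedUpTo x<C (N1 i a y n aᵢ₊₁≡1+n) bounded y≤x =
  All-[]≔ (inject₁ i) (All-[]≔ (fsuc i) a≤C (decremented-≤ (fsuc i) a≤C aᵢ₊₁≡1+n))
    (≤-<-trans y≤x x<C)
  where a≤C = bounded y≤x
Step-preserves-BoundedUpTo x<C (N2 a y n a₀≡1+n) bounded 1+y≤x =
  All-[]≔ fzero a≤C (decremented-≤ fzero a≤C a₀≡1+n)
  where a≤C = bounded (<⇒≤ 1+y≤x)

⇝N-preserves-BoundedUpTo : ∀ {k C x} {c c′ : Config k} → x < C →
  c ⇝N c′ → BoundedUpTo C x c → BoundedUpTo C x c′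
⇝N-preserves-BoundedUpTo x<C ε       = λ bounded → bounded
⇝N-preserves-BoundedUpTo x<C (s ◅ r) =
  ⇝N-preserves-BoundedUpTo x<C r ∘ Step-preserves-BoundedUpTo x<C s

lemma9 : (k : ℕ) (b : Vec ℕ (suc k)) (x : ℕ) →
    IsFinite (λ (a : Vec ℕ (suc k)) → ∃ λ (y : ℕ) → (b , y) ⇝N (a , x))
lemma9 k b x = vecsBoundedBy C (suc k) , λ _ (_ , b⇝a) →
  ∈-vecsBoundedBy (⇝N-preserves-BoundedUpTo x<C b⇝a b≤C ≤-refl)
  where
  C = sum b + suc x
  x<C : x < C
  x<C = m≤n+m (suc x) (sum b)
  b≤C : ∀ {y} → BoundedUpTo C x (b , y)
  b≤C _ = All.map (λ bⱼ≤Σb → ≤-trans bⱼ≤Σb (m≤m+n (sum b) (suc x))) (All-≤-sum b)
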